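{- Let $G$ be a quasi $f$-graph of type $(0,b)$ on a vertex set $V$. If $G$ is not an $[m:n]$-graph for any positive integers $m,n$, then $G$ is connected.
   Context: $G$ is a finite simple graph on $V=\{v_1,\dots,v_N\}$ with no isolated vertices. For positive integers $m,n$, $G$ is an $[m:n]$-graph if its complement $\overline{G}$ is the complete bipartite graph $K_{m,n}$ on $m+n$ vertices, i.e. $G=K_m\sqcup K_n$. Let $k$ be a field, $R=k[x_1,\dots,x_N]$, $x_F=\prod_{v_i\in F}x_i$. For a square-free monomial ideal $I\subseteq R$ with minimal generating set $G(I)$: the facet complex $\delta_{\mathcal F}(I)$ is the simplicial complex whose facets are the sets $\{v_{i_1},\dots,v_{i_r}\}$ with $x_{i_1}\cdots x_{i_r}\in G(I)$; the non-face complex $\delta_{\mathcal N}(I)$ is $\{F\subseteq V: x_F\notin I\}$. The $f$-vector of a $d$-dimensional complex is $(f_0,\dots,f_d)$, $f_i$ the number of faces with $i+1$ elements. $I$ is a quasi $f$-ideal of type $(a_1,\dots,a_s)\in\mathbb Z^s$ if $f(\delta_{\mathcal N}(I))-f(\delta_{\mathcal F}(I))=(a_1,\dots,a_s)$, both $f$-vectors lying in $\mathbb Z^s$. $G$ is a quasi $f$-graph of type $(0,b)$ if its edge ideal $I(G)=(x_ix_j:\{v_i,v_j\}\in E(G))$ is a quasi $f$-ideal of type $(0,b)$. -}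

module Defs where

open import Data.Nat using (ℕ; zero; suc; _<_; _≤_; _>_)
open import Data.Integer as ℤ using (ℤ; +_; _-_)
open import Data.Bool using (Bool; true; false; _∧_; _∨_; not; if_then_else_)
open import Data.Fin as Fin using (Fin)
open import Data.Fin.Subset using (Subset; ∣_∣; _∈_; _∉_; ⁅_⁆; _∪_)
open import Data.Vec using (Vec; []; _∷_; lookup)
open import Data.List using (List; []; _∷_; map; _++_; length; filter; allFin)
open import Data.Bool.ListAction using (any; all)
open import Data.Bool using (T)
open import Data.Bool.Properties using (T?)
open import Data.Product using (Σ; ∃; _×_; _,_)
open import Relation.Binary.PropositionalEquality using (_≡_; _≢_)
open import Relation.Binary.Construct.Closure.ReflexiveTransitive using (Star)
open import Function.Bundles using (_⇔_)
open import Relation.Nullary using (¬_)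
import Data.Nat as ℕ

record Graph (N : ℕ) : Set where
  field
    adj     : Fin N → Fin N → Bool
    symm    : ∀ u v → adj u v ≡ adj v u
    irrefl  : ∀ v → adj v v ≡ false
    noIsolated : ∀ v → ∃ λ u → adj v u ≡ true
open Graph public

allSubsets : (n : ℕ) → List (Subset n)
allSubsets zero = [] ∷ []
allSubsets (suc n) = map (true ∷_) (allSubsets n) ++ map (false ∷_) (allSubsets n)

mem : ∀ {n} → Fin n → Subset n → Bool
mem i F = lookup F i

subsetB : ∀ {n} → Subset n → Subset n → Bool
subsetB {n} F F' = all (λ i → not (mem i F) ∨ mem i F') (allFin n)

-- Face predicate of the facet complex δ_F(I(G)): the minimal generators of the
-- edge ideal are the monomials x_u x_v for edges {u,v}, so the facets are the
-- edges and F is a face iff F ⊆ {u,v} for some edge {u,v}.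
facetFace : ∀ {N} → Graph N → Subset N → Bool
facetFace {N} G F =
  any (λ u → any (λ v → adj G u v ∧ subsetB F (⁅ u ⁆ ∪ ⁅ v ⁆)) (allFin N)) (allFin N)

-- Face predicate of the non-face complex δ_N(I(G)) = {F : x_F ∉ I(G)}.
-- The square-free monomial x_F lies in the monomial ideal I(G) iff it is divisible
-- by some generator x_u x_v, i.e. iff F contains both endpoints of some edge.
nonFaceFace : ∀ {N} → Graph N → Subset N → Bool
nonFaceFace {N} G F =
  not (any (λ u → any (λ v → adj G u v ∧ (mem u F ∧ mem v F)) (allFin N)) (allFin N))

faceCount : ∀ {N} → (Subset N → Bool) → ℕ → ℕ
faceCount {N} Δ k = length (filter (λ F → T? (Δ F ∧ (∣ F ∣ ℕ.≡ᵇ k))) (allSubsets N))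

-- The f-vector (f_0, …, f_d) of a d-dimensional complex "lies in ℤ^s" iff d = s - 1,
-- i.e. s ≥ 1, there is a face with s elements, and no face with more than s elements.
FVecIn : ∀ {N} → (Subset N → Bool) → ℕ → Set
FVecIn Δ s = 1 ℕ.≤ s × 0 < faceCount Δ s × (∀ k → s < k → faceCount Δ k ≡ 0)

-- i-th entry f_i (i = 0 … s-1) counts faces with i+1 elements.
fEntry : ∀ {N} → (Subset N → Bool) → ℕ → ℤ
fEntry Δ i = + faceCount Δ (suc i)

-- I(G) is a quasi f-ideal of type (a_1,…,a_s) (here a : Fin s → ℤ, a_{i+1} = a i).
IsQuasiFIdealOfType : ∀ {N} → Graph N → (s : ℕ) → (Fin s → ℤ) → Set
IsQuasiFIdealOfType G s a =
  FVecIn (nonFaceFace G) s × FVecIn (facetFace G) s ×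
  (∀ (i : Fin s) → a i ≡ fEntry (nonFaceFace G) (Fin.toℕ i) - fEntry (facetFace G) (Fin.toℕ i))

type0b : ℤ → Fin 2 → ℤ
type0b b Fin.zero = + 0
type0b b (Fin.suc _) = b

IsQuasiFGraphOfType0b : ∀ {N} → Graph N → ℤ → Set
IsQuasiFGraphOfType0b G b = IsQuasiFIdealOfType G 2 (type0b b)

-- G is an [m:n]-graph: its complement is K_{m,n} on the m+n vertices, i.e. there is
-- a bipartition V = A ⊔ (V∖A) with |A| = m, |V∖A| = n, such that distinct u,v are
-- non-adjacent in G iff they lie on different sides.
IsMNGraph : ∀ {N} → Graph N → ℕ → ℕ → Set
IsMNGraph {N} G m n =
  N ≡ m ℕ.+ n × Σ (Subset N) λ A → ∣ A ∣ ≡ m ×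
    (∀ u v → u ≢ v → (adj G u v ≡ false ⇔ (¬ (mem u A ≡ mem v A))))

Adjacent : ∀ {N} → Graph N → Fin N → Fin N → Set
Adjacent G u v = adj G u v ≡ true

Connected : ∀ {N} → Graph N → Set
Connected {N} G = ∀ (u v : Fin N) → Star (Adjacent G) u v

-- By the f-vector condition of type (0,b), the non-face complex of I(G) has no
-- face with three elements, i.e. G has no independent set of size 3. Suppose u
-- and v are distinct and non-adjacent, and let A be the closed neighbourhood of u.
-- Every vertex outside A is v or adjacent to v, since otherwise it would form an
-- independent triple with u and v. So an edge leaving A yields a walk from u to v.
-- If no edge leaves A, then A and its complement are cliques (again because there
-- is no independent triple) with no edges between them, so G = K_m ⊔ K_n with
-- m = |A| ≥ 1 and n = N - |A| ≥ 1, which is excluded.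
module Submission where

open import Defs
open import Data.Nat using (ℕ; _≥_; zero; suc; _<_; _∸_; _≡ᵇ_; z≤n)
open import Data.Integer using (ℤ)
open import Relation.Nullary using (¬_; Dec; yes; no; contradiction)
open import Data.Nat.Properties using (≡⇒≡ᵇ; <⇒≢; ≤-<-trans; m+[n∸m]≡n; n<1+n)
open import Data.Bool using (Bool; true; false; _∧_; _∨_; T)
open import Data.Bool.Properties as Bool using (T?; T-∧; T-≡; T-not-≡; ¬-not)
open import Data.Fin as Fin using (Fin; _≟_)
open import Data.Fin.Properties using (any?)
open import Data.Fin.Subset using (Subset; ∣_∣; _∈_; _∉_; ⁅_⁆; _∪_; inside; outside)
open import Data.Fin.Subset.Properties
  using (∪-identityˡ; ∣p∣≤n; x∈⁅y⁆⇒x≡y; x≢y⇒x∉⁅y⁆; x∈p∪q⁻; ∣⁅x⁆∣≡1; x∈p⇒∣p-x∣<∣p∣; x∉p⇒x∈∁p; ∣∁p∣≡n∸∣p∣)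
open import Data.Vec using ([]; _∷_; here; there; tabulate)
open import Data.Vec.Properties using (lookup∘tabulate; lookup⇒[]=; []=⇒lookup)
open import Data.List using (map; allFin)
open import Data.Bool.ListAction using (any)
open import Data.List.Properties using (filter-some)
open import Data.List.Membership.Propositional as List using ()
open import Data.List.Membership.Propositional.Properties using (∈-map⁺; ∈-++⁺ˡ; ∈-++⁺ʳ)
open import Data.List.Relation.Unary.Any as Any using (satisfied)
open import Data.List.Relation.Unary.Any.Properties using (any⁻)
open import Data.Product using (∃; _×_; _,_)
open import Data.Sum as Sum using (_⊎_; inj₁; inj₂)
open import Data.Empty using (⊥)
open import Relation.Nullary.Decidable using (⌊_⌋; _×-dec_)
open import Relation.Binary.PropositionalEquality using (_≡_; _≢_; refl; sym; trans; cong; subst; module ≡-Reasoning)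
open import Relation.Binary.Construct.Closure.ReflexiveTransitive using (Star; ε; _◅_; _◅◅_)
open import Function using (_∘_)
open import Function.Bundles using (mk⇔; Equivalence)

open Equivalence using (from; to)

mem⇒∈ : ∀ {n} {x : Fin n} (p : Subset n) → mem x p ≡ true → x ∈ p
mem⇒∈ {x = x} p = lookup⇒[]= x p

mem⇒∉ : ∀ {n} {x : Fin n} (p : Subset n) → mem x p ≡ false → x ∉ p
mem⇒∉ p x∉p x∈p = contradiction (trans (sym x∉p) ([]=⇒lookup x∈p)) λ ()

x∈p⇒0<∣p∣ : ∀ {n} {x : Fin n} {p : Subset n} → x ∈ p → 0 < ∣ p ∣
x∈p⇒0<∣p∣ x∈p = ≤-<-trans z≤n (x∈p⇒∣p-x∣<∣p∣ x∈p)

∣⁅x⁆∪p∣≡1+∣p∣ : ∀ {n} {x : Fin n} (p : Subset n) → x ∉ p → ∣ ⁅ x ⁆ ∪ p ∣ ≡ suc ∣ p ∣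
∣⁅x⁆∪p∣≡1+∣p∣ {x = Fin.zero}  (inside  ∷ p) x∉p = contradiction here x∉p
∣⁅x⁆∪p∣≡1+∣p∣ {x = Fin.zero}  (outside ∷ p) x∉p = cong (λ q → suc ∣ q ∣) (∪-identityˡ p)
∣⁅x⁆∪p∣≡1+∣p∣ {x = Fin.suc x} (inside  ∷ p) x∉p = cong suc (∣⁅x⁆∪p∣≡1+∣p∣ p (λ x∈p → x∉p (there x∈p)))
∣⁅x⁆∪p∣≡1+∣p∣ {x = Fin.suc x} (outside ∷ p) x∉p = ∣⁅x⁆∪p∣≡1+∣p∣ p (λ x∈p → x∉p (there x∈p))

allSubsets-complete : ∀ {n} (F : Subset n) → F List.∈ allSubsets n
allSubsets-complete {zero} [] = Any.here refl
allSubsets-complete {suc n} (inside ∷ F) = ∈-++⁺ˡ (∈-map⁺ (inside ∷_) (allSubsets-complete F))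
allSubsets-complete {suc n} (outside ∷ F) =
  ∈-++⁺ʳ (map (inside ∷_) (allSubsets n)) (∈-map⁺ (outside ∷_) (allSubsets-complete F))

faceCount-pos : ∀ {N} (Δ : Subset N → Bool) (F : Subset N) → T (Δ F) → 0 < faceCount Δ ∣ F ∣
faceCount-pos Δ F ΔF =
  filter-some (λ F′ → T? (Δ F′ ∧ (∣ F′ ∣ ≡ᵇ ∣ F ∣)))
    (Any.map (λ { refl → from T-∧ (ΔF , ≡⇒≡ᵇ ∣ F ∣ ∣ F ∣ refl) }) (allSubsets-complete F))

Independent : ∀ {N} → Graph N → Subset N → Set
Independent G F = ∀ {u v} → u ∈ F → v ∈ F → adj G u v ≡ false

independent⇒nonFace : ∀ {N} (G : Graph N) {F : Subset N} → Independent G F → T (nonFaceFace G F)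
independent⇒nonFace {N} G {F} indep = from T-not-≡ (¬-not λ hasEdge → edgeInside (edge-witness hasEdge))
  where
  edgeInside : ¬ ∃ λ u → ∃ λ v → T (adj G u v ∧ (mem u F ∧ mem v F))
  edgeInside (u , v , t) with to T-∧ t
  ... | uv , u∈F,v∈F with to T-∧ u∈F,v∈F
  ... | u∈F , v∈F =
    subst T (indep (mem⇒∈ F (to T-≡ u∈F)) (mem⇒∈ F (to T-≡ v∈F))) uv
  edge-witness : any (λ u → any (λ v → adj G u v ∧ (mem u F ∧ mem v F)) (allFin N)) (allFin N) ≡ true →
           ∃ λ u → ∃ λ v → T (adj G u v ∧ (mem u F ∧ mem v F))
  edge-witness e with satisfied (any⁻ _ (allFin N) (from T-≡ e))
  ... | u , t = u , satisfied (any⁻ _ (allFin N) t)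

module _ {n : ℕ} {a b c : Fin n} where

  ∈⁅a,b,c⁆⁻ : ∀ {x} → x ∈ ⁅ a ⁆ ∪ ⁅ b ⁆ ∪ ⁅ c ⁆ → x ≡ a ⊎ x ≡ b ⊎ x ≡ c
  ∈⁅a,b,c⁆⁻ = Sum.map (x∈⁅y⁆⇒x≡y a) (Sum.map (x∈⁅y⁆⇒x≡y b) (x∈⁅y⁆⇒x≡y c) ∘ x∈p∪q⁻ _ _) ∘ x∈p∪q⁻ _ _

  ∣⁅a,b,c⁆∣≡3 : a ≢ b → a ≢ c → b ≢ c → ∣ ⁅ a ⁆ ∪ ⁅ b ⁆ ∪ ⁅ c ⁆ ∣ ≡ 3
  ∣⁅a,b,c⁆∣≡3 a≢b a≢c b≢c = begin
    ∣ ⁅ a ⁆ ∪ ⁅ b ⁆ ∪ ⁅ c ⁆ ∣  ≡⟨ ∣⁅x⁆∪p∣≡1+∣p∣ (⁅ b ⁆ ∪ ⁅ c ⁆) a∉⁅b,c⁆ ⟩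
    suc ∣ ⁅ b ⁆ ∪ ⁅ c ⁆ ∣      ≡⟨ cong suc (∣⁅x⁆∪p∣≡1+∣p∣ ⁅ c ⁆ (x≢y⇒x∉⁅y⁆ b≢c)) ⟩
    suc (suc ∣ ⁅ c ⁆ ∣)        ≡⟨ cong (suc ∘ suc) (∣⁅x⁆∣≡1 c) ⟩
    3                          ∎
    where
    open ≡-Reasoning
    a∉⁅b,c⁆ : a ∉ ⁅ b ⁆ ∪ ⁅ c ⁆
    a∉⁅b,c⁆ = Sum.[ a≢b ∘ x∈⁅y⁆⇒x≡y b , a≢c ∘ x∈⁅y⁆⇒x≡y c ] ∘ x∈p∪q⁻ ⁅ b ⁆ ⁅ c ⁆

NoIndependentTriple : ∀ {N} → Graph N → Set
NoIndependentTriple {N} G = ∀ {a b c : Fin N} → a ≢ b → a ≢ c → b ≢ c →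
  adj G a b ≡ false → adj G a c ≡ false → adj G b c ≡ false → ⊥

module _ {N} (G : Graph N) where

  nonadjacent-sym : ∀ {x y} → adj G x y ≡ false → adj G y x ≡ false
  nonadjacent-sym {x} {y} = trans (symm G y x)

  adjacent-sym : ∀ {x y} → adj G x y ≡ true → adj G y x ≡ true
  adjacent-sym {x} {y} = trans (symm G y x)

  independent-triple : ∀ {a b c} → adj G a b ≡ false → adj G a c ≡ false → adj G b c ≡ false →
                       Independent G (⁅ a ⁆ ∪ ⁅ b ⁆ ∪ ⁅ c ⁆)
  independent-triple {a} {b} {c} a≁b a≁c b≁c x∈ y∈ = nonadjacent (∈⁅a,b,c⁆⁻ x∈) (∈⁅a,b,c⁆⁻ y∈)
    where
    nonadjacent : ∀ {x y} → x ≡ a ⊎ x ≡ b ⊎ x ≡ c → y ≡ a ⊎ y ≡ b ⊎ y ≡ c → adj G x y ≡ false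
    nonadjacent {x} (inj₁ refl)        (inj₁ refl)        = irrefl G x
    nonadjacent     (inj₁ refl)        (inj₂ (inj₁ refl)) = a≁b
    nonadjacent     (inj₁ refl)        (inj₂ (inj₂ refl)) = a≁c
    nonadjacent     (inj₂ (inj₁ refl)) (inj₁ refl)        = nonadjacent-sym a≁b
    nonadjacent {x} (inj₂ (inj₁ refl)) (inj₂ (inj₁ refl)) = irrefl G x
    nonadjacent     (inj₂ (inj₁ refl)) (inj₂ (inj₂ refl)) = b≁c
    nonadjacent     (inj₂ (inj₂ refl)) (inj₁ refl)        = nonadjacent-sym a≁c
    nonadjacent     (inj₂ (inj₂ refl)) (inj₂ (inj₁ refl)) = nonadjacent-sym b≁c
    nonadjacent {x} (inj₂ (inj₂ refl)) (inj₂ (inj₂ refl)) = irrefl G x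

  noNonFace3⇒noIndependentTriple : faceCount (nonFaceFace G) 3 ≡ 0 → NoIndependentTriple G
  noNonFace3⇒noIndependentTriple noFace3 {a} {b} {c} a≢b a≢c b≢c a≁b a≁c b≁c =
    <⇒≢ (subst (λ k → 0 < faceCount (nonFaceFace G) k) (∣⁅a,b,c⁆∣≡3 a≢b a≢c b≢c) nonFace3)
        (sym noFace3)
    where
    nonFace3 : 0 < faceCount (nonFaceFace G) ∣ ⁅ a ⁆ ∪ ⁅ b ⁆ ∪ ⁅ c ⁆ ∣
    nonFace3 = faceCount-pos (nonFaceFace G) (⁅ a ⁆ ∪ ⁅ b ⁆ ∪ ⁅ c ⁆)
                 (independent⇒nonFace G (independent-triple a≁b a≁c b≁c))

  mem-true-false⇒≢ : ∀ (A : Subset N) {x y} → mem x A ≡ true → mem y A ≡ false → x ≢ y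
  mem-true-false⇒≢ A x∈A y∉A refl = contradiction (trans (sym x∈A) y∉A) λ ()

  closedNeighbourhood : Fin N → Subset N
  closedNeighbourhood u = tabulate λ w → adj G u w ∨ ⌊ w ≟ u ⌋

  module _ {u : Fin N} where

    private
      N[u] : Subset N
      N[u] = closedNeighbourhood u

      mem-N[u] : ∀ x → mem x N[u] ≡ (adj G u x ∨ ⌊ x ≟ u ⌋)
      mem-N[u] x = lookup∘tabulate (λ w → adj G u w ∨ ⌊ w ≟ u ⌋) x

    u∈N[u] : mem u N[u] ≡ true
    u∈N[u] rewrite mem-N[u] u with adj G u u | u ≟ u
    ... | true  | _     = refl
    ... | false | yes _ = refl
    ... | false | no u≢u = contradiction refl u≢u

    ∈N[u]⁻ : ∀ {x} → mem x N[u] ≡ true → adj G u x ≡ true ⊎ x ≡ u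
    ∈N[u]⁻ {x} x∈ rewrite mem-N[u] x with adj G u x | x ≟ u
    ... | true  | _       = inj₁ refl
    ... | false | yes x≡u = inj₂ x≡u

    ∉N[u]⁻ : ∀ {x} → mem x N[u] ≡ false → adj G u x ≡ false × x ≢ u
    ∉N[u]⁻ {x} x∉ rewrite mem-N[u] x with adj G u x | x ≟ u
    ... | false | no x≢u = refl , x≢u

    ∈N[u]⇒walk : ∀ {x} → mem x N[u] ≡ true → Star (Adjacent G) u x
    ∈N[u]⇒walk x∈ with ∈N[u]⁻ x∈
    ... | inj₁ u~x  = u~x ◅ ε
    ... | inj₂ refl = ε

  CrossEdge : Subset N → Set
  CrossEdge A = ∃ λ x → ∃ λ y → mem x A ≡ true × mem y A ≡ false × adj G x y ≡ true

  crossEdge? : (A : Subset N) → Dec (CrossEdge A)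
  crossEdge? A = any? λ x → any? λ y →
    (mem x A Bool.≟ true) ×-dec (mem y A Bool.≟ false) ×-dec (adj G x y Bool.≟ true)

  noCrossEdge⇒nonadjacent : ∀ (A : Subset N) {x y} → ¬ CrossEdge A → mem x A ≡ true → mem y A ≡ false →
                            adj G x y ≡ false
  noCrossEdge⇒nonadjacent A noCross x∈A y∉A = ¬-not λ x~y → noCross (_ , _ , x∈A , y∉A , x~y)

  module _ (noTriple : NoIndependentTriple G) {u v : Fin N} (u≢v : u ≢ v) (u≁v : adj G u v ≡ false) where

    private
      A : Subset N
      A = closedNeighbourhood u

    nonNeighbours-adjacent : ∀ {a b c} → a ≢ b → a ≢ c → b ≢ c →
                             adj G a b ≡ false → adj G a c ≡ false → adj G b c ≡ true
    nonNeighbours-adjacent a≢b a≢c b≢c a≁b a≁c = ¬-not (noTriple a≢b a≢c b≢c a≁b a≁c)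

    outside-adjacent : ∀ {x y} → mem x A ≡ false → mem y A ≡ false → x ≢ y → adj G x y ≡ true
    outside-adjacent x∉A y∉A x≢y with ∉N[u]⁻ x∉A | ∉N[u]⁻ y∉A
    ... | u≁x , x≢u | u≁y , y≢u = nonNeighbours-adjacent (x≢u ∘ sym) (y≢u ∘ sym) x≢y u≁x u≁y

    v∉A : mem v A ≡ false
    v∉A = ¬-not λ v∈A → Sum.[ (λ u~v → contradiction (trans (sym u~v) u≁v) λ ()) , u≢v ∘ sym ] (∈N[u]⁻ v∈A)

    crossEdge⇒walk : CrossEdge A → Star (Adjacent G) u v
    crossEdge⇒walk (x , y , x∈A , y∉A , x~y) = ∈N[u]⇒walk x∈A ◅◅ x~y ◅ walk-to-v y∉A
      where
      walk-to-v : ∀ {y} → mem y A ≡ false → Star (Adjacent G) y v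
      walk-to-v {y} y∉A with y ≟ v
      ... | yes refl = ε
      ... | no y≢v   = outside-adjacent y∉A v∉A y≢v ◅ ε

    inside-adjacent : ∀ {x y} → ¬ CrossEdge A → mem x A ≡ true → mem y A ≡ true → x ≢ y →
                      adj G x y ≡ true
    inside-adjacent noCross x∈A y∈A x≢y with ∈N[u]⁻ x∈A | ∈N[u]⁻ y∈A
    ... | inj₂ refl | inj₂ refl = contradiction refl x≢y
    ... | inj₂ refl | inj₁ u~y  = u~y
    ... | inj₁ u~x  | inj₂ refl = adjacent-sym u~x
    ... | inj₁ _    | inj₁ _    =
      nonNeighbours-adjacent (mem-true-false⇒≢ A x∈A v∉A ∘ sym) (mem-true-false⇒≢ A y∈A v∉A ∘ sym) x≢y
        (nonadjacent-sym (noCrossEdge⇒nonadjacent A noCross x∈A v∉A))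
        (nonadjacent-sym (noCrossEdge⇒nonadjacent A noCross y∈A v∉A))

    nonadjacent⇒separated : ¬ CrossEdge A → ∀ {x y} → x ≢ y → adj G x y ≡ false → mem x A ≢ mem y A
    nonadjacent⇒separated noCross {x} x≢y x≁y same with mem x A in x∈?A
    ... | true  = contradiction (trans (sym (inside-adjacent noCross x∈?A (sym same) x≢y)) x≁y) λ ()
    ... | false = contradiction (trans (sym (outside-adjacent x∈?A (sym same) x≢y)) x≁y) λ ()

    separated⇒nonadjacent : ¬ CrossEdge A → ∀ {x y} → mem x A ≢ mem y A → adj G x y ≡ false
    separated⇒nonadjacent noCross {x} {y} separated with mem x A in x∈?A | mem y A in y∈?A
    ... | true  | false = noCrossEdge⇒nonadjacent A noCross x∈?A y∈?A
    ... | false | true  = nonadjacent-sym (noCrossEdge⇒nonadjacent A noCross y∈?A x∈?A)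
    ... | true  | true  = contradiction refl separated
    ... | false | false = contradiction refl separated

    noCrossEdge⇒[m:n] : ¬ CrossEdge A → IsMNGraph G ∣ A ∣ (N ∸ ∣ A ∣)
    noCrossEdge⇒[m:n] noCross = sym (m+[n∸m]≡n (∣p∣≤n A)) , A , refl , λ x y x≢y →
      mk⇔ (nonadjacent⇒separated noCross x≢y) (separated⇒nonadjacent noCross)

    nonadjacent-walk : (∀ m n → m ≥ 1 → n ≥ 1 → ¬ IsMNGraph G m n) → Star (Adjacent G) u v
    nonadjacent-walk notMN with crossEdge? A
    ... | yes crossEdge = crossEdge⇒walk crossEdge
    ... | no noCross    = contradiction (noCrossEdge⇒[m:n] noCross) (notMN ∣ A ∣ (N ∸ ∣ A ∣) 0<∣A∣ 0<∣∁A∣)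
      where
      0<∣A∣ : 0 < ∣ A ∣
      0<∣A∣ = x∈p⇒0<∣p∣ (mem⇒∈ A (u∈N[u] {u}))
      0<∣∁A∣ : 0 < N ∸ ∣ A ∣
      0<∣∁A∣ = subst (0 <_) (∣∁p∣≡n∸∣p∣ A) (x∈p⇒0<∣p∣ (x∉p⇒x∈∁p (mem⇒∉ A v∉A)))

  connected : NoIndependentTriple G → (∀ m n → m ≥ 1 → n ≥ 1 → ¬ IsMNGraph G m n) → Connected G
  connected noTriple notMN u v with u ≟ v | adj G u v in u~?v
  ... | yes refl | _     = ε
  ... | no _     | true  = u~?v ◅ ε
  ... | no u≢v   | false = nonadjacent-walk noTriple u≢v u~?v notMN

corollary4p3 : ∀ {N : ℕ} (G : Graph N) (b : ℤ) →
    IsQuasiFGraphOfType0b G b →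
    (∀ (m n : ℕ) → m ≥ 1 → n ≥ 1 → ¬ IsMNGraph G m n) →
    Connected G
corollary4p3 G b ((_ , _ , noLargeNonFace) , _ , _) notMN =
  connected G (noNonFace3⇒noIndependentTriple G (noLargeNonFace 3 (n<1+n 2))) notMN
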